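{- Let $n$ be a positive integer and $m$ an integer. If $n\ge (m-1)(m-2)+2$, then $\Lambda_n\ge m$.
   Context: An $n$-th order Latin Square is an $n\times n$ grid filled with the symbols $1,\dots,n$ such that each symbol appears exactly once in each row and each column. A monotone subsequence is a subsequence that is strictly increasing or strictly decreasing. $\Lambda_n$ is defined as the largest integer such that every $n$-th order Latin Square has a row (read left to right) or a column (read top to bottom) containing a monotone subsequence of length $\Lambda_n$. -}

module Defs where

open import Data.Nat using (ℕ; suc; _+_; _*_)
open import Data.Integer as ℤ using (ℤ; +_)
open import Data.Fin using (Fin; _<_; _>_)
open import Data.Product using (Σ; ∃; _×_)
open import Data.Sum using (_⊎_)
open import Function.Definitions using (Injective)
open import Relation.Binary.PropositionalEquality using (_≡_)

-- Symbols 1,…,n are represented by Fin n (i.e. 0,…,n-1), order-preserving.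

record LatinSquare (n : ℕ) : Set where
  field
    entry     : Fin n → Fin n → Fin n
    row-once  : ∀ i s → Σ (Fin n) (λ j → entry i j ≡ s) × (∀ j j' → entry i j ≡ s → entry i j' ≡ s → j ≡ j')
    col-once  : ∀ j s → Σ (Fin n) (λ i → entry i j ≡ s) × (∀ i i' → entry i j ≡ s → entry i' j ≡ s → i ≡ i')

StrictlyIncreasing : ∀ {k n} → (Fin k → Fin n) → Set
StrictlyIncreasing g = ∀ a b → a < b → g a < g b

StrictlyDecreasing : ∀ {k n} → (Fin k → Fin n) → Set
StrictlyDecreasing g = ∀ a b → a < b → g a > g b

HasMonotoneSubseq : ∀ {n} → (Fin n → Fin n) → ℕ → Set
HasMonotoneSubseq {n} f k =
  Σ (Fin k → Fin n) λ g → StrictlyIncreasing g ×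
    (StrictlyIncreasing (λ a → f (g a)) ⊎ StrictlyDecreasing (λ a → f (g a)))

rowSeq : ∀ {n} → LatinSquare n → Fin n → (Fin n → Fin n)
rowSeq L i j = LatinSquare.entry L i j

colSeq : ∀ {n} → LatinSquare n → Fin n → (Fin n → Fin n)
colSeq L j i = LatinSquare.entry L i j

-- Property P_n(k): every n-th order Latin square has a row or a column
-- containing a monotone subsequence of length k.  (k is an integer; a
-- length must be a natural number, so negative k never qualifies here.)
EveryLSHasMonotoneLine : ℕ → ℤ → Set
EveryLSHasMonotoneLine n k =
  Σ ℕ λ k' → (k ≡ + k') ×
    ((L : LatinSquare n) →
      (Σ (Fin n) λ i → HasMonotoneSubseq (rowSeq L i) k') ⊎
      (Σ (Fin n) λ j → HasMonotoneSubseq (colSeq L j) k'))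

IsLambda : ℕ → ℤ → Set
IsLambda n Lam = EveryLSHasMonotoneLine n Lam × (∀ k → EveryLSHasMonotoneLine n k → k ℤ.≤ Lam)

module Submission where

-- Write m = a + 1 and n = n' + 1, so the hypothesis says
-- a(a-1) < n'.  Any Latin square has a row whose first entry is the largest
-- symbol n'.  The remaining n' entries of that row are distinct and all lie
-- below the first one, so by the Erdős–Szekeres theorem (a sequence of more
-- than r·s distinct values has an increasing subsequence of length r+1 or a
-- decreasing one of length s+1, applied with r = a, s = a-1) they contain an
-- increasing subsequence of length a+1, or a decreasing one of length a which
-- the first entry extends to length a+1.  Hence m has the defining property of
-- Λ_n, and m ≤ Λ_n by maximality; for m ≤ 0 the claim holds since Λ_n ≥ 0.

open import Defs
open import Data.Nat as ℕ using (ℕ)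
open import Data.Integer using (ℤ; +_; _+_; _-_; _*_; _≤_)

open import Data.Nat using (zero; suc; _⊔_; _∸_; z≤n; s≤s)
import Data.Nat.Properties as ℕP
import Data.Integer as ℤ
import Data.Integer.Properties as ℤP
open import Data.Fin as Fin using (Fin; zero; suc; toℕ; fromℕ; fromℕ<; inject≤; combine)
import Data.Fin.Properties as FinP
open import Data.Product using (Σ; ∃₂; _×_; _,_; proj₁; proj₂)
open import Data.Sum using (_⊎_; inj₁; inj₂)
open import Data.Empty using (⊥; ⊥-elim)
open import Function using (_∘_)
open import Function.Definitions using (Injective)
open import Relation.Nullary using (¬_; Dec; yes; no)
open import Relation.Binary using (Decidable; Transitive; tri<; tri≈; tri>)
open import Relation.Binary.PropositionalEquality

maxOver : ∀ {N} → (Fin N → ℕ) → ℕ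
maxOver {zero}  h = 0
maxOver {suc N} h = h zero ⊔ maxOver (h ∘ suc)

maxOver-upper : ∀ {N} (h : Fin N → ℕ) (i : Fin N) → h i ℕ.≤ maxOver h
maxOver-upper {suc N} h zero    = ℕP.m≤m⊔n (h zero) _
maxOver-upper {suc N} h (suc i) =
  ℕP.≤-trans (maxOver-upper (h ∘ suc) i) (ℕP.m≤n⊔m (h zero) _)

maxOver-attained : ∀ {N} (h : Fin N → ℕ) →
                   maxOver h ≡ 0 ⊎ Σ (Fin N) λ i → h i ≡ maxOver h
maxOver-attained {zero}  h = inj₁ refl
maxOver-attained {suc N} h with maxOver-attained (h ∘ suc)
... | inj₁ tail≡0 =
  inj₂ (zero , sym (trans (cong (h zero ⊔_) tail≡0) (ℕP.⊔-identityʳ (h zero))))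
... | inj₂ (i , hi≡tail) with ℕP.⊔-sel (h zero) (maxOver (h ∘ suc))
...   | inj₁ head-wins = inj₂ (zero , sym head-wins)
...   | inj₂ tail-wins = inj₂ (suc i , trans hi≡tail (sym tail-wins))

module Chains {V : Set} (R : V → V → Set) where

  Chain : ∀ {N} → (Fin N → V) → ℕ → Set
  Chain {N} f k = Σ (Fin k → Fin N) λ g →
    StrictlyIncreasing g × (∀ a b → a Fin.< b → R (f (g a)) (f (g b)))

  ChainFrom : ∀ {N} → (Fin N → V) → Fin N → ℕ → Set
  ChainFrom f j k = Σ (Chain f (suc k)) λ c → proj₁ c zero ≡ j

  singleton : ∀ {N} (f : Fin N → V) (j : Fin N) → ChainFrom f j 0
  singleton f j = ((λ _ → j) , (λ { zero zero () }) , (λ { zero zero () })) , refl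

  shift : ∀ {N k} {f : Fin (suc N) → V} → Chain (f ∘ suc) k → Chain f k
  shift (g , inc , rel) = suc ∘ g , (λ a b a<b → s≤s (inc a b a<b)) , rel

  prepend : ∀ {N k} {f : Fin (suc N) → V} (c : Chain (f ∘ suc) k) →
            (∀ b → R (f zero) (f (suc (proj₁ c b)))) → Chain f (suc k)
  prepend {N} {k} {f} (g , inc , rel) below = g′ , inc′ , rel′
    where
      g′ : Fin (suc k) → Fin (suc N)
      g′ zero    = zero
      g′ (suc a) = suc (g a)

      inc′ : StrictlyIncreasing g′
      inc′ zero    (suc b) _         = s≤s z≤n
      inc′ (suc a) (suc b) (s≤s a<b) = s≤s (inc a b a<b)

      rel′ : ∀ a b → a Fin.< b → R (f (g′ a)) (f (g′ b))
      rel′ zero    (suc b) _         = below b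
      rel′ (suc a) (suc b) (s≤s a<b) = rel a b a<b

  shorten : ∀ {N k m} {f : Fin N → V} → m ℕ.≤ k → Chain f k → Chain f m
  shorten m≤k (g , inc , rel) =
    g ∘ embed , (λ a b → inc _ _ ∘ embed-mono a b) , (λ a b → rel _ _ ∘ embed-mono a b)
    where
      embed : Fin _ → Fin _
      embed a = inject≤ a m≤k
      embed-mono : ∀ a b → a Fin.< b → embed a Fin.< embed b
      embed-mono a b =
        subst₂ ℕ._<_ (sym (FinP.toℕ-inject≤ a m≤k)) (sym (FinP.toℕ-inject≤ b m≤k))

module LongestChain {V : Set} (R : V → V → Set) (R? : Decidable R)
                    (R-trans : Transitive R) where
  open Chains R

  -- The chain length (minus one) obtained from value v by continuing with a
  -- chain of length x+1 whose first value is w.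
  step : V → V → ℕ → ℕ
  step v w x with R? v w
  ... | yes _ = suc x
  ... | no  _ = 0

  step-related : ∀ {v w} x → R v w → step v w x ≡ suc x
  step-related {v} {w} x r with R? v w
  ... | yes _  = refl
  ... | no ¬r = ⊥-elim (¬r r)

  step-unrelated : ∀ {v w} x → ¬ R v w → step v w x ≡ 0
  step-unrelated {v} {w} x ¬r with R? v w
  ... | yes r = ⊥-elim (¬r r)
  ... | no  _ = refl

  -- len f j + 1 is the length of a longest chain in f starting at j.
  len : ∀ {N} → (Fin N → V) → Fin N → ℕ
  len {suc N} f zero    = maxOver (λ i → step (f zero) (f (suc i)) (len (f ∘ suc) i))
  len {suc N} f (suc i) = len (f ∘ suc) i

  -- A later position with an R-related value has a strictly shorter longest
  -- chain, since such a chain can be prefixed by the earlier position.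
  len-decreasing : ∀ {N} (f : Fin N → V) (i j : Fin N) → i Fin.< j → R (f i) (f j) →
                   len f j ℕ.< len f i
  len-decreasing {suc N} f zero (suc j) _ r =
    subst (ℕ._≤ len f zero) (step-related (len (f ∘ suc) j) r)
      (maxOver-upper (λ i → step (f zero) (f (suc i)) (len (f ∘ suc) i)) j)
  len-decreasing {suc N} f (suc i) (suc j) (s≤s i<j) r = len-decreasing (f ∘ suc) i j i<j r

  shiftFrom : ∀ {N k} {f : Fin (suc N) → V} {j} →
              ChainFrom (f ∘ suc) j k → ChainFrom f (suc j) k
  shiftFrom {f = f} (c , starts-at-j) = shift {f = f} c , cong suc starts-at-j

  -- Prefixing by position 0 only needs the first value to be R-related to the
  -- first value of the chain, by transitivity.
  prependFrom : ∀ {N k} {f : Fin (suc N) → V} {j} → R (f zero) (f (suc j)) →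
                ChainFrom (f ∘ suc) j k → ChainFrom f zero (suc k)
  prependFrom {f = f} r (c@(g , _ , rel) , starts-at-j) = prepend {f = f} c below , refl
    where
      below : ∀ b → R (f zero) (f (suc (g b)))
      below zero    = subst (λ x → R (f zero) (f (suc x))) (sym starts-at-j) r
      below (suc b) = R-trans (below zero) (rel zero (suc b) (s≤s z≤n))

  longest : ∀ {N} (f : Fin N → V) (j : Fin N) → ChainFrom f j (len f j)
  longest {suc N} f (suc i) = shiftFrom {f = f} (longest (f ∘ suc) i)
  longest {suc N} f zero
    with maxOver-attained (λ i → step (f zero) (f (suc i)) (len (f ∘ suc) i))
  ... | inj₁ len≡0 = subst (ChainFrom f zero) (sym len≡0) (singleton f zero)
  ... | inj₂ (i , attains) = continueWith (R? (f zero) (f (suc i)))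
    where
      continueWith : Dec (R (f zero) (f (suc i))) → ChainFrom f zero (len f zero)
      continueWith (yes r)  = subst (ChainFrom f zero) (trans (sym (step-related _ r)) attains)
                                (prependFrom {f = f} r (longest (f ∘ suc) i))
      continueWith (no ¬r) = subst (ChainFrom f zero) (trans (sym (step-unrelated _ ¬r)) attains)
                                (singleton f zero)

IncChain DecChain : ∀ {N n} → (Fin N → Fin n) → ℕ → Set
IncChain = Chains.Chain Fin._<_
DecChain = Chains.Chain Fin._>_

module Increasing {n} = LongestChain (Fin._<_ {n}) Fin._<?_ FinP.<-trans
module Decreasing {n} =
  LongestChain (Fin._>_ {n}) (λ x y → y Fin.<? x) (λ x>y y>z → FinP.<-trans y>z x>y)

labels-distinct : ∀ {N n} (f : Fin N → Fin n) → Injective _≡_ _≡_ f →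
                  ∀ {x y} → x Fin.< y →
                  Increasing.len f x ≡ Increasing.len f y →
                  Decreasing.len f x ≡ Decreasing.len f y → ⊥
labels-distinct f inj {x} {y} x<y sameInc sameDec with FinP.<-cmp (f x) (f y)
... | tri< fx<fy _ _ = ℕP.<-irrefl (sym sameInc) (Increasing.len-decreasing f x y x<y fx<fy)
... | tri≈ _ fx≡fy _ = FinP.<-irrefl (inj fx≡fy) x<y
... | tri> _ _ fx>fy = ℕP.<-irrefl (sym sameDec) (Decreasing.len-decreasing f x y x<y fx>fy)

-- If all increasing chains are shorter than r+1 and all decreasing ones
-- shorter than s+1, the labels are distinct elements of an (r·s)-element set.
short-chains-bound : ∀ {N n} (f : Fin N → Fin n) → Injective _≡_ _≡_ f → ∀ r s →
                     (∀ j → Increasing.len f j ℕ.< r) →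
                     (∀ j → Decreasing.len f j ℕ.< s) →
                     ¬ (r ℕ.* s ℕ.< N)
short-chains-bound {N} f inj r s inc<r dec<s rs<N = collision (FinP.pigeonhole rs<N label)
  where
    label : Fin N → Fin (r ℕ.* s)
    label j = combine (fromℕ< (inc<r j)) (fromℕ< (dec<s j))

    collision : (∃₂ λ x y → x Fin.< y × label x ≡ label y) → ⊥
    collision (x , y , x<y , same) =
      labels-distinct f inj x<y
        (FinP.fromℕ<-injective _ _ (inc<r x) (inc<r y) (proj₁ components))
        (FinP.fromℕ<-injective _ _ (dec<s x) (dec<s y) (proj₂ components))
      where components = FinP.combine-injective _ _ _ _ same

erdos-szekeres : ∀ {N n} (f : Fin N → Fin n) → Injective _≡_ _≡_ f →
                 ∀ r s → r ℕ.* s ℕ.< N →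
                 IncChain f (suc r) ⊎ DecChain f (suc s)
erdos-szekeres f inj r s rs<N with FinP.any? (λ j → r ℕ.≤? Increasing.len f j)
... | yes (j , r≤len) =
  inj₁ (Chains.shorten Fin._<_ {f = f} (s≤s r≤len) (proj₁ (Increasing.longest f j)))
... | no noLongInc with FinP.any? (λ j → s ℕ.≤? Decreasing.len f j)
...   | yes (j , s≤len) =
  inj₂ (Chains.shorten Fin._>_ {f = f} (s≤s s≤len) (proj₁ (Decreasing.longest f j)))
...   | no noLongDec = ⊥-elim (short-chains-bound f inj r s
                         (λ j → ℕP.≰⇒> (λ r≤len → noLongInc (j , r≤len)))
                         (λ j → ℕP.≰⇒> (λ s≤len → noLongDec (j , s≤len)))
                         rs<N)

increasing-monotone : ∀ {n k} {f : Fin n → Fin n} → IncChain f k → HasMonotoneSubseq f k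
increasing-monotone (g , g-inc , f∘g-inc) = g , g-inc , inj₁ f∘g-inc

decreasing-monotone : ∀ {n k} {f : Fin n → Fin n} → DecChain f k → HasMonotoneSubseq f k
decreasing-monotone (g , g-inc , f∘g-dec) = g , g-inc , inj₂ f∘g-dec

below-top : ∀ {N n'} (f : Fin N → Fin (suc n')) → Injective _≡_ _≡_ f → ∀ {i j} →
            f i ≡ fromℕ n' → j ≢ i → f j Fin.< f i
below-top {n' = n'} f inj {i} {j} fi≡top j≢i =
  subst (f j Fin.<_) (sym fi≡top) (ℕP.≤∧≢⇒< (FinP.≤fromℕ (f j)) fj≢top)
  where
    fj≢top : toℕ (f j) ≢ toℕ (fromℕ n')
    fj≢top e = j≢i (inj (trans (FinP.toℕ-injective e) (sym fi≡top)))

-- A row that starts with the largest symbol n' has a monotone subsequence of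
-- length a+1 when a(a-1) < n': Erdős–Szekeres on the remaining n' entries
-- (r = a, s = a-1), extending a decreasing subsequence by the first entry.
top-first-monotone : ∀ {n'} (f : Fin (suc n') → Fin (suc n')) → Injective _≡_ _≡_ f →
                     f zero ≡ fromℕ n' → ∀ a → a ℕ.* (a ∸ 1) ℕ.< n' →
                     HasMonotoneSubseq f (suc a)
top-first-monotone f inj f0≡top a bound
  with erdos-szekeres (f ∘ suc) (FinP.suc-injective ∘ inj) a (a ∸ 1) bound
... | inj₁ increasing = increasing-monotone {f = f} (Chains.shift Fin._<_ {f = f} increasing)
... | inj₂ decreasing = decreasing-monotone {f = f} (Chains.shorten Fin._>_ {f = f} a+1≤a-1+2
                          (Chains.prepend Fin._>_ {f = f} decreasing (λ _ → first-above _)))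
  where
    a+1≤a-1+2 : suc a ℕ.≤ suc (suc (a ∸ 1))
    a+1≤a-1+2 = s≤s (ℕP.m≤n+m∸n a 1)

    first-above : ∀ j → f zero Fin.> f (suc j)
    first-above j = below-top f inj f0≡top (λ ())

-- Every Latin square of order n'+1 has a row with a monotone subsequence of
-- length a+1 when a(a-1) < n': the row whose first entry is the largest symbol.
latin-monotone-row : ∀ {n'} a → a ℕ.* (a ∸ 1) ℕ.< n' → (L : LatinSquare (suc n')) →
                     Σ (Fin (suc n')) λ i → HasMonotoneSubseq (rowSeq L i) (suc a)
latin-monotone-row {n'} a bound L =
  i , top-first-monotone (entry i) row-injective starts-with-top a bound
  where
    open LatinSquare L
    i : Fin (suc n')
    i = proj₁ (proj₁ (col-once zero (fromℕ n')))

    starts-with-top : entry i zero ≡ fromℕ n'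
    starts-with-top = proj₂ (proj₁ (col-once zero (fromℕ n')))

    row-injective : Injective _≡_ _≡_ (entry i)
    row-injective {x} {y} same = proj₂ (row-once i (entry i x)) x y refl (sym same)

-- The hypothesis (m-1)(m-2)+2 ≤ n for m = a+1 and n = n'+1.
hypothesis-bound : ∀ a n' → (+ suc a - + 1) * (+ suc a - + 2) + + 2 ≤ + suc n' →
                   a ℕ.* (a ∸ 1) ℕ.< n'
hypothesis-bound a n' hyp =
  ℕP.≤-pred (subst (ℕ._≤ suc n') (ℕP.+-comm (a ℕ.* (a ∸ 1)) 2)
    (ℤP.drop‿+≤+ (subst (_≤ + suc n') (as-ℕ a) hyp)))
  where
    as-ℕ : ∀ a → (+ suc a - + 1) * (+ suc a - + 2) + + 2 ≡ + (a ℕ.* (a ∸ 1) ℕ.+ 2)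
    as-ℕ zero          = refl
    as-ℕ (suc zero)    = refl
    as-ℕ (suc (suc c)) = refl

-- Λ_n is the length of some monotone subsequence, hence nonnegative.
lambda-nonneg : ∀ {n Lam} → IsLambda n Lam → + 0 ≤ Lam
lambda-nonneg ((_ , refl , _) , _) = ℤ.+≤+ z≤n

-- For m ≥ 1 the row lemma shows that m has the defining property of Λ_n, so
-- m ≤ Λ_n by maximality; for m ≤ 0 it suffices that Λ_n ≥ 0.
theorem12 : (n : ℕ) → 0 ℕ.< n → (m : ℤ) →
    (m - + 1) * (m - + 2) + + 2 ≤ + n →
    (Lam : ℤ) → IsLambda n Lam → m ≤ Lam
theorem12 (suc n') _ (+ suc a) hyp Lam (_ , maximal) =
  maximal (+ suc a) (suc a , refl , λ L → inj₁ (latin-monotone-row a bound L))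
  where
    bound : a ℕ.* (a ∸ 1) ℕ.< n'
    bound = hypothesis-bound a n' hyp
theorem12 _ _ (+ zero)    _ Lam isLambda = lambda-nonneg isLambda
theorem12 _ _ ℤ.-[1+ _ ] _ Lam isLambda = ℤP.≤-trans ℤ.-≤+ (lambda-nonneg isLambda)
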